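{- Let $G=(V,E)$ be a finite simple undirected graph, let $S_{cyc}\subseteq\{0,1\}^E$ be the set of orientations $f$ of $G$ such that $\vec G^f$ has a directed cycle, and let $\overline{S_{cyc}}=\{0,1\}^E\setminus S_{cyc}$ be the set of acyclic orientations. Then (i) $\{X\subseteq E : G_{E\setminus X}\text{ has a cycle}\}=\mathrm{sstr}(S_{cyc})$; (ii) $\{X\subseteq E : G_X\text{ is a forest}\}=\mathrm{str}(\overline{S_{cyc}})$.
   Context: Fix an arbitrary reference direction for each edge of $G$. An orientation of $G$ is a function $f\in\{0,1\}^E$; $\vec G^f$ is the digraph obtained by directing each edge $e$ along its reference direction if $f(e)=0$ and against it if $f(e)=1$. For $X\subseteq E$, $G_X$ denotes the graph $(V,X)$. For disjoint sets $A,B$ and $g\in\{0,1\}^A$, $h\in\{0,1\}^B$, $g\star h\in\{0,1\}^{A\cup B}$ is the function agreeing with $g$ on $A$ and with $h$ on $B$. For $S\subseteq\{0,1\}^E$ and $Y\subseteq E$: $S$ shatters $Y$ if for every $h\in\{0,1\}^Y$ there exists $g\in\{0,1\}^{E\setminus Y}$ with $g\star h\in S$; $S$ strongly shatters $Y$ if there exists $g\in\{0,1\}^{E\setminus Y}$ such that $g\star h\in S$ for every $h\in\{0,1\}^Y$. $\mathrm{str}(S)$ and $\mathrm{sstr}(S)$ denote the families of subsets of $E$ shattered, respectively strongly shattered, by $S$. -}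

module Defs where

open import Data.Nat using (ℕ; suc; _≥_)
open import Data.Fin using (Fin; zero; suc; inject₁; fromℕ)
open import Data.Bool using (Bool; true; false; if_then_else_)
open import Data.Product using (Σ; ∃; _×_; _,_)
open import Data.Sum using (_⊎_)
open import Relation.Binary.PropositionalEquality using (_≡_; _≢_)
open import Relation.Nullary using (¬_)
open import Function.Definitions using (Injective)

-- Each edge e has endpoints src e , tgt e ; the pair (src e , tgt e) is also
-- the (arbitrary, fixed) reference direction of e.
record Graph : Set where
  field
    n m      : ℕ
    src tgt  : Fin m → Fin n
    loopless : ∀ e → src e ≢ tgt e
    simple   : ∀ e e' → ((src e ≡ src e' × tgt e ≡ tgt e') ⊎ (src e ≡ tgt e' × tgt e ≡ src e'))
                      → e ≡ e'

module _ (G : Graph) where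
  open Graph G

  V = Fin n
  E = Fin m

  -- subsets of E and {0,1}^E (false = 0, true = 1)
  EdgeSet = E → Bool
  Orientation = E → Bool

  _∈E_ : E → EdgeSet → Set
  e ∈E X = X e ≡ true

  Joins : E → V → V → Set
  Joins e a b = (src e ≡ a × tgt e ≡ b) ⊎ (src e ≡ b × tgt e ≡ a)

  tail head : Orientation → E → V
  tail f e = if f e then tgt e else src e
  head f e = if f e then src e else tgt e

  HasCycle : EdgeSet → Set
  HasCycle X = Σ ℕ λ k → k ≥ 2 × Σ (Fin (suc k) → V) λ v → Σ (Fin (suc k) → E) λ es →
      Injective _≡_ _≡_ v × Injective _≡_ _≡_ es
    × (∀ i → es i ∈E X)
    × (∀ (i : Fin k) → Joins (es (inject₁ i)) (v (inject₁ i)) (v (suc i)))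
    × Joins (es (fromℕ k)) (v (fromℕ k)) (v zero)

  IsForest : EdgeSet → Set
  IsForest X = ¬ HasCycle X

  HasDirCycle : Orientation → Set
  HasDirCycle f = Σ ℕ λ k → Σ (Fin (suc k) → V) λ v → Σ (Fin (suc k) → E) λ es →
      Injective _≡_ _≡_ v × Injective _≡_ _≡_ es
    × (∀ (i : Fin k) → tail f (es (inject₁ i)) ≡ v (inject₁ i) × head f (es (inject₁ i)) ≡ v (suc i))
    × (tail f (es (fromℕ k)) ≡ v (fromℕ k) × head f (es (fromℕ k)) ≡ v zero)

  S-cyc : Orientation → Set
  S-cyc f = HasDirCycle f

  S-acyc : Orientation → Set
  S-acyc f = ¬ S-cyc f

  -- g ⋆ h for the partition E = (E ∖ Y) ∪ Y ; g is only read on E ∖ Y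
  -- and h only on Y, so total functions represent {0,1}^(E∖Y), {0,1}^Y.
  _⋆[_]_ : Orientation → EdgeSet → Orientation → Orientation
  (g ⋆[ Y ] h) e = if Y e then h e else g e

  Shatters : (Orientation → Set) → EdgeSet → Set
  Shatters S Y = ∀ (h : Orientation) → ∃ λ (g : Orientation) → S (g ⋆[ Y ] h)

  StronglyShatters : (Orientation → Set) → EdgeSet → Set
  StronglyShatters S Y = ∃ λ (g : Orientation) → ∀ (h : Orientation) → S (g ⋆[ Y ] h)

  compl : EdgeSet → EdgeSet
  compl X e = if X e then false else true

module Submission where

-- Two facts about a single graph carry the whole proof.
--  * (cycle-orientation) A cycle C ⊆ Z can be traversed in one direction; this
--    fixes an orientation g on Z such that every orientation agreeing with g on Z
--    contains C as a directed cycle.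
--  * (forest-or-potential) For every edge set Y and every orientation f, either
--    G_Y has a cycle, or there is a potential p : V → ℤ strictly increasing along
--    every edge of Y as oriented by f.  It is proved by a union–find sweep over
--    the edges of Y: components carry a label and a potential, an edge inside a
--    component closes a cycle (the component is connected by a simple path), and
--    an edge between two components merges them after shifting one potential.
-- Given a potential p, ranking vertices lexicographically by (p, index) gives a
-- strict total order; an orientation in which every edge ascends it is acyclic
-- (ascending⇒acyclic).

open import Defs
open import Data.Bool using (Bool; true; false; if_then_else_)
import Data.Bool.Properties as BoolP
open import Data.Empty using (⊥-elim)
open import Data.Fin as Fin using (Fin; zero; suc; inject₁; fromℕ; toℕ; _≟_)
import Data.Fin.Properties as FinP
open import Data.Integer as ℤ using (ℤ; 0ℤ; _+_; _-_; _<_)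
import Data.Integer.Properties as ℤP
open import Data.Integer.Tactic.RingSolver using (solve-∀)
open import Data.List using (List; []; _∷_; _++_; [_]; map; length; lookup)
import Data.List.Properties as ListP
open import Data.List.Membership.Propositional.Properties using (∈-map⁺; ∈-lookup)
open import Data.List.Relation.Unary.All as All using (All; []; _∷_)
import Data.List.Relation.Unary.All.Properties as AllP
open import Data.List.Relation.Unary.AllPairs using ([]; _∷_)
open import Data.List.Relation.Unary.Any using (here; there)
open import Data.List.Relation.Unary.Unique.Propositional using (Unique)
import Data.List.Relation.Unary.Unique.Propositional.Properties as UniqueP
open import Data.List.Relation.Binary.Permutation.Propositional using (↭-sym; ↭⇒↭ₛ)
open import Data.List.Relation.Binary.Permutation.Propositional.Properties using (∷↭∷ʳ)
import Data.List.Relation.Binary.Permutation.Setoid.Properties as PermutationP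
open import Data.Nat as ℕ using (ℕ; zero; suc; _≥_; s≤s; z≤n)
import Data.Nat.Properties as ℕP
open import Data.Product using (Σ; ∃; _×_; _,_; proj₁; proj₂)
open import Data.Product.Relation.Binary.Lex.Strict using (×-Lex; ×-isStrictTotalOrder)
open import Data.Sum as Sum using (_⊎_; inj₁; inj₂)
open import Function using (_∘_)
open import Function.Bundles using (_⇔_; mk⇔)
open import Function.Definitions using (Injective)
open import Level using (0ℓ)
open import Relation.Binary.Definitions using (Transitive; Decidable; tri<; tri≈; tri>)
open import Relation.Binary.Structures using (IsStrictTotalOrder)
open import Relation.Binary.PropositionalEquality
  using (_≡_; _≢_; refl; sym; trans; cong; subst; subst₂; setoid; module ≡-Reasoning)
open import Relation.Nullary using (¬_; Dec; yes; no; does)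
open import Relation.Nullary.Decidable using (dec-true; dec-false; _×-dec_)
open import Relation.Unary using (Pred; _⊆_; _∪_; ｛_｝; _∉_; Empty)

chain : {A : Set} (R : A → A → Set) → Transitive R → ∀ k (v : Fin (suc k) → A)
  → (∀ (i : Fin k) → R (v (inject₁ i)) (v (suc i)))
  → v zero ≡ v (fromℕ k) ⊎ R (v zero) (v (fromℕ k))
chain R R-trans zero v steps = inj₁ refl
chain R R-trans (suc k) v steps with chain R R-trans k (v ∘ inject₁) (steps ∘ inject₁)
... | inj₁ eq = inj₂ (subst (λ x → R x (v (suc (fromℕ k)))) (sym eq) (steps (fromℕ k)))
... | inj₂ r  = inj₂ (R-trans r (steps (fromℕ k)))

lookup-injective : {A B : Set} (f : A → B) (xs : List A) → Unique (map f xs)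
  → Injective _≡_ _≡_ (λ i → f (lookup xs i))
lookup-injective f (x ∷ xs) _ {zero} {zero} _ = refl
lookup-injective f (x ∷ xs) (fresh ∷ _) {zero} {suc j} eq =
  ⊥-elim (All.lookup fresh (∈-map⁺ f (∈-lookup {xs = xs} j)) eq)
lookup-injective f (x ∷ xs) (fresh ∷ _) {suc i} {zero} eq =
  ⊥-elim (All.lookup fresh (∈-map⁺ f (∈-lookup {xs = xs} i)) (sym eq))
lookup-injective f (x ∷ xs) (_ ∷ unique) {suc i} {suc j} eq =
  cong suc (lookup-injective f xs unique eq)

unique-rotate : {A : Set} (a : A) (xs : List A) → Unique (xs ++ [ a ]) → Unique (a ∷ xs)
unique-rotate {A} a xs = PermutationP.Unique-resp-↭ (setoid A) (↭⇒↭ₛ (↭-sym (∷↭∷ʳ a xs)))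

distinct-from : {A : Set} {P : Pred A 0ℓ} {a : A} {xs : List A} → a ∉ P → All P xs → All (a ≢_) xs
distinct-from a∉P = All.map (λ p a≡x → a∉P (subst _ (sym a≡x) p))

module Orientations (G : Graph) where
  open Graph G

  agree-on : ∀ (o o' : Orientation G) e → o e ≡ o' e
    → tail G o e ≡ tail G o' e × head G o e ≡ head G o' e
  agree-on o o' e eq = cong (λ b → if b then tgt e else src e) eq
                     , cong (λ b → if b then src e else tgt e) eq

  joins-tail-head : ∀ (o : Orientation G) e → Joins G e (tail G o e) (head G o e)
  joins-tail-head o e with o e
  ... | true  = inj₂ (refl , refl)
  ... | false = inj₁ (refl , refl)

  joins-sym : ∀ {e x y} → Joins G e x y → Joins G e y x
  joins-sym (inj₁ (s , t)) = inj₂ (s , t)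
  joins-sym (inj₂ (s , t)) = inj₁ (s , t)

  joins-distinct : ∀ {e x y} → Joins G e x y → x ≢ y
  joins-distinct {e} (inj₁ (s , t)) x≡y = loopless e (trans s (trans x≡y (sym t)))
  joins-distinct {e} (inj₂ (s , t)) x≡y = loopless e (trans s (trans (sym x≡y) (sym t)))

  same-endpoints : ∀ {e e' x y} → Joins G e x y → Joins G e' x y → e ≡ e'
  same-endpoints (inj₁ (s , t)) (inj₁ (s' , t')) = simple _ _ (inj₁ (trans s (sym s') , trans t (sym t')))
  same-endpoints (inj₁ (s , t)) (inj₂ (s' , t')) = simple _ _ (inj₂ (trans s (sym t') , trans t (sym s')))
  same-endpoints (inj₂ (s , t)) (inj₁ (s' , t')) = simple _ _ (inj₂ (trans s (sym t') , trans t (sym s')))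
  same-endpoints (inj₂ (s , t)) (inj₂ (s' , t')) = simple _ _ (inj₁ (trans s (sym s') , trans t (sym t')))

  labels-along : ∀ {A : Set} (c : V G → A) {e x y} → c (src e) ≡ c (tgt e) → Joins G e x y
    → c (src e) ≡ c x × c y ≡ c x
  labels-along c h (inj₁ (refl , refl)) = refl , sym h
  labels-along c h (inj₂ (refl , refl)) = h , h

  labels-across : ∀ {A : Set} (c : V G → A) {e x y} → c x ≡ c y → Joins G e x y
    → c (src e) ≡ c (tgt e)
  labels-across c h (inj₁ (refl , refl)) = h
  labels-across c h (inj₂ (refl , refl)) = sym h

  -- If every edge ascends a strict order, there is no directed cycle:
  -- following the cycle would give v₀ < v₀.
  ascending⇒acyclic : {_<ᵥ_ : V G → V G → Set} → Transitive _<ᵥ_ → (∀ {x} → ¬ x <ᵥ x)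
    → (o : Orientation G) → (∀ e → tail G o e <ᵥ head G o e) → ¬ HasDirCycle G o
  ascending⇒acyclic {_<ᵥ_} <-trans <-irrefl o ascends (k , v , es , _ , _ , steps , t-last , h-last)
    with chain _<ᵥ_ <-trans k v (λ i → subst₂ _<ᵥ_ (proj₁ (steps i)) (proj₂ (steps i)) (ascends (es (inject₁ i))))
  ... | inj₁ eq = <-irrefl (subst₂ _<ᵥ_ (trans t-last (sym eq)) h-last (ascends (es (fromℕ k))))
  ... | inj₂ r  = <-irrefl (<-trans r (subst₂ _<ᵥ_ t-last h-last (ascends (es (fromℕ k)))))

  upward : {_<ᵥ_ : V G → V G → Set} → Decidable _<ᵥ_ → Orientation G
  upward _<?_ e = does (tgt e <? src e)

  upward-ascends : {_<ᵥ_ : V G → V G → Set} (_<?_ : Decidable _<ᵥ_)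
    → (∀ {x y} → x ≢ y → x <ᵥ y ⊎ y <ᵥ x)
    → ∀ e → tail G (upward _<?_) e <ᵥ head G (upward _<?_) e
  upward-ascends _<?_ comparable e with tgt e <? src e
  ... | yes tgt<src = tgt<src
  ... | no  tgt≮src with comparable (loopless e)
  ...   | inj₁ src<tgt = src<tgt
  ...   | inj₂ tgt<src = ⊥-elim (tgt≮src tgt<src)

  out-of : E G → V G → Bool
  out-of e a = does (tgt e ≟ a)

  directed-out-of : ∀ {e a b} → Joins G e a b
    → (if out-of e a then tgt e else src e) ≡ a × (if out-of e a then src e else tgt e) ≡ b
  directed-out-of {e} {a} joins with tgt e ≟ a | joins
  ... | yes tgt≡a | inj₁ (s , _) = ⊥-elim (loopless e (trans s (sym tgt≡a)))
  ... | yes tgt≡a | inj₂ (s , _) = tgt≡a , s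
  ... | no  _     | inj₁ (s , t) = s , t
  ... | no  tgt≢a | inj₂ (_ , t) = ⊥-elim (tgt≢a t)

  cycle-orientation : (Z : EdgeSet G) → HasCycle G Z → Σ (Orientation G) λ g →
    ∀ (o : Orientation G) → (∀ e → Z e ≡ true → o e ≡ g e) → HasDirCycle G o
  cycle-orientation Z (k , _ , v , es , v-inj , es-inj , in-Z , steps , last) =
    g , λ o agrees → k , v , es , v-inj , es-inj
                   , (λ i → directed o agrees (inject₁ i) (steps i)) , directed o agrees (fromℕ k) last
    where
    choose : ∀ e → Dec (∃ λ i → es i ≡ e) → Bool
    choose e (yes (i , _)) = out-of e (v i)
    choose e (no _)        = false

    g : Orientation G
    g e = choose e (FinP.any? (λ i → es i ≟ e))

    g-on-cycle : ∀ i (d : Dec (∃ λ j → es j ≡ es i)) → choose (es i) d ≡ out-of (es i) (v i)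
    g-on-cycle i (yes (j , eq)) rewrite es-inj eq = refl
    g-on-cycle i (no none)      = ⊥-elim (none (i , refl))

    directed : ∀ (o : Orientation G) → (∀ e → Z e ≡ true → o e ≡ g e) → ∀ i {b} → Joins G (es i) (v i) b
      → tail G o (es i) ≡ v i × head G o (es i) ≡ b
    directed o agrees i joins =
      let o≡g = trans (agrees (es i) (in-Z i)) (g-on-cycle i (FinP.any? (λ j → es j ≟ es i)))
          (t , h) = agree-on o (λ _ → out-of (es i) (v i)) (es i) o≡g
          (t' , h') = directed-out-of joins
      in trans t t' , trans h h'

module PotentialOrder (G : Graph) (p : V G → ℤ) where
  open Graph G
  open Orientations G

  rank : V G → ℤ × V G
  rank x = p x , x

  _≺_ : V G → V G → Set
  x ≺ y = ×-Lex _≡_ ℤ._<_ Fin._<_ (rank x) (rank y)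

  private
    lex = ×-isStrictTotalOrder ℤP.<-isStrictTotalOrder (FinP.<-isStrictTotalOrder {n})
    module Lex = IsStrictTotalOrder lex

  ≺-trans : Transitive _≺_
  ≺-trans = Lex.trans

  ≺-irrefl : ∀ {x} → ¬ x ≺ x
  ≺-irrefl = Lex.irrefl (refl , refl)

  _≺?_ : Decidable _≺_
  x ≺? y = rank x Lex.<? rank y

  ≺-comparable : ∀ {x y} → x ≢ y → x ≺ y ⊎ y ≺ x
  ≺-comparable {x} {y} x≢y with Lex.compare (rank x) (rank y)
  ... | tri< x≺y _ _ = inj₁ x≺y
  ... | tri≈ _ (_ , x≡y) _ = ⊥-elim (x≢y x≡y)
  ... | tri> _ _ y≺x = inj₂ y≺x

  acyclic-mix : (o f : Orientation G)
    → (∀ e → o e ≡ upward _≺?_ e ⊎ (o e ≡ f e × p (tail G f e) < p (head G f e)))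
    → ¬ HasDirCycle G o
  acyclic-mix o f cases = ascending⇒acyclic {_<ᵥ_ = _≺_} ≺-trans ≺-irrefl o ascends
    where
    ascends : ∀ e → tail G o e ≺ head G o e
    ascends e with cases e
    ... | inj₁ o≡up = let (t , h) = agree-on o (upward _≺?_) e o≡up
                      in subst₂ _≺_ (sym t) (sym h) (upward-ascends _≺?_ ≺-comparable e)
    ... | inj₂ (o≡f , increases) = let (t , h) = agree-on o f e o≡f
                                   in subst₂ _≺_ (sym t) (sym h) (inj₁ increases)

module Walks (G : Graph) where
  open Graph G
  open Orientations G

  -- A walk records, for each step, the vertex it leaves and the edge it uses.
  Step : Set
  Step = V G × E G

  data Walk : V G → V G → List Step → Set where
    nil  : ∀ {u} → Walk u u []
    cons : ∀ {u v w e ps} → Joins G e u v → Walk v w ps → Walk u w ((u , e) ∷ ps)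

  vertices : List Step → V G → List (V G)
  vertices ps w = map proj₁ ps ++ [ w ]

  edges : List Step → List (E G)
  edges ps = map proj₂ ps

  record SimplePath (D : Pred (E G) 0ℓ) (u v : V G) : Set where
    field
      steps             : List Step
      walk              : Walk u v steps
      distinct-vertices : Unique (vertices steps v)
      distinct-edges    : Unique (edges steps)
      within            : All D (edges steps)

  trivial-path : ∀ {D u} → SimplePath D u u
  trivial-path = record { steps = [] ; walk = nil ; distinct-vertices = [] ∷ []
                        ; distinct-edges = [] ; within = [] }

  widen : ∀ {D D' u v} → D ⊆ D' → SimplePath D u v → SimplePath D' u v
  widen D⊆D' P = record { steps = steps ; walk = walk ; distinct-vertices = distinct-vertices
                        ; distinct-edges = distinct-edges ; within = All.map D⊆D' within }
    where open SimplePath P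

  walk-++ : ∀ {x y w ps qs} → Walk x y ps → Walk y w qs → Walk x w (ps ++ qs)
  walk-++ nil        q = q
  walk-++ (cons j r) q = cons j (walk-++ r q)

  vertices-splice : ∀ ps y e qs w → vertices (ps ++ (y , e) ∷ qs) w ≡ vertices ps y ++ vertices qs w
  vertices-splice ps y e qs w = begin
    map proj₁ (ps ++ (y , e) ∷ qs) ++ [ w ]          ≡⟨ cong (_++ [ w ]) (ListP.map-++ proj₁ ps ((y , e) ∷ qs)) ⟩
    (map proj₁ ps ++ y ∷ map proj₁ qs) ++ [ w ]      ≡⟨ ListP.++-assoc (map proj₁ ps) (y ∷ map proj₁ qs) [ w ] ⟩
    map proj₁ ps ++ y ∷ map proj₁ qs ++ [ w ]        ≡⟨ sym (ListP.++-assoc (map proj₁ ps) [ y ] (map proj₁ qs ++ [ w ])) ⟩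
    (map proj₁ ps ++ [ y ]) ++ map proj₁ qs ++ [ w ] ∎
    where open ≡-Reasoning

  walk-joins : ∀ {u w x ps} → Walk u w (x ∷ ps) → ∀ (i : Fin (length ps)) →
    Joins G (proj₂ (lookup (x ∷ ps) (inject₁ i))) (proj₁ (lookup (x ∷ ps) (inject₁ i)))
            (proj₁ (lookup (x ∷ ps) (suc i)))
  walk-joins (cons j (cons _ _)) zero    = j
  walk-joins (cons _ (cons j r)) (suc i) = walk-joins (cons j r) i

  walk-last : ∀ {u w x ps} → Walk u w (x ∷ ps) →
    Joins G (proj₂ (lookup (x ∷ ps) (fromℕ (length ps)))) (proj₁ (lookup (x ∷ ps) (fromℕ (length ps)))) w
  walk-last (cons j nil)        = j
  walk-last (cons _ (cons j r)) = walk-last (cons j r)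

  walk-long : ∀ {x y ps} → Walk x y ps → x ≢ y → All (λ e → ¬ Joins G e x y) (edges ps)
    → length ps ≥ 2
  walk-long nil                 x≢y _             = ⊥-elim (x≢y refl)
  walk-long (cons j nil)        _   (¬j ∷ _)      = ⊥-elim (¬j j)
  walk-long (cons _ (cons _ _)) _   _             = s≤s (s≤s z≤n)

  constant-along : ∀ {D : Pred (E G) 0ℓ} (c : V G → V G) → (∀ {e} → D e → c (src e) ≡ c (tgt e))
    → ∀ {u w ps} → Walk u w ps → All D (edges ps)
    → All (λ x → c x ≡ c u) (vertices ps w) × All (λ e → c (src e) ≡ c u) (edges ps)
  constant-along c c-edge nil [] = refl ∷ [] , []
  constant-along c c-edge (cons j r) (d ∷ ds) =
    let (src≡u , v≡u) = labels-along c (c-edge d) j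
        (on-vertices , on-edges) = constant-along c c-edge r ds
    in refl ∷ All.map (λ x≡v → trans x≡v v≡u) on-vertices
     , src≡u ∷ All.map (λ x≡v → trans x≡v v≡u) on-edges

  close-cycle : ∀ {D : Pred (E G) 0ℓ} (Y : EdgeSet G) → D ⊆ (λ e → Y e ≡ true)
    → ∀ {e₀ a b} → Y e₀ ≡ true → e₀ ∉ D → Joins G e₀ a b → SimplePath D b a → HasCycle G Y
  close-cycle {D} Y D⊆Y {e₀} {a} {b} e₀∈Y e₀∉D joins P =
    length steps , long , v , es , v-inj , es-inj , in-Y , walk-joins cyc , walk-last cyc
    where
    open SimplePath P
    cs : List Step
    cs = (a , e₀) ∷ steps
    cyc : Walk a a cs
    cyc = cons joins walk
    v : Fin (suc (length steps)) → V G
    v i = proj₁ (lookup cs i)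
    es : Fin (suc (length steps)) → E G
    es i = proj₂ (lookup cs i)
    long : length steps ≥ 2
    long = walk-long walk (joins-distinct (joins-sym joins))
             (All.map (λ d j → e₀∉D (subst D (sym (same-endpoints joins (joins-sym j))) d)) within)
    v-inj : Injective _≡_ _≡_ v
    v-inj = lookup-injective proj₁ cs (unique-rotate a (map proj₁ steps) distinct-vertices)
    es-inj : Injective _≡_ _≡_ es
    es-inj = lookup-injective proj₂ cs (distinct-from e₀∉D within ∷ distinct-edges)
    in-Y : ∀ i → Y (es i) ≡ true
    in-Y zero    = e₀∈Y
    in-Y (suc i) = D⊆Y (All.lookup within (∈-map⁺ proj₂ (∈-lookup {xs = steps} i)))

  splice : ∀ {D : Pred (E G) 0ℓ} (c : V G → V G) → (∀ {e} → D e → c (src e) ≡ c (tgt e))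
    → ∀ {e₀ x y z w} → e₀ ∉ D → SimplePath D x y → Joins G e₀ y z → SimplePath D z w
    → c x ≢ c z → SimplePath (D ∪ ｛ e₀ ｝) x w
  splice {D} c c-edge {e₀} {x} {y} {z} {w} e₀∉D P joins Q apart = record
    { steps             = ps ++ (y , e₀) ∷ qs
    ; walk              = walk-++ (SimplePath.walk P) (cons joins (SimplePath.walk Q))
    ; distinct-vertices = subst Unique (sym (vertices-splice ps y e₀ qs w))
        (UniqueP.++⁺ (SimplePath.distinct-vertices P) (SimplePath.distinct-vertices Q)
          λ { (∈P , ∈Q) → apart (trans (sym (All.lookup onP ∈P)) (All.lookup onQ ∈Q)) })
    ; distinct-edges    = subst Unique (sym edges-splice)
        (UniqueP.++⁺ (SimplePath.distinct-edges P)
          (distinct-from e₀∉D (SimplePath.within Q) ∷ SimplePath.distinct-edges Q)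
          λ { (∈P , here refl) → e₀∉D (All.lookup (SimplePath.within P) ∈P)
            ; (∈P , there ∈Q)  → apart (trans (sym (All.lookup srcP ∈P)) (All.lookup srcQ ∈Q)) })
    ; within            = subst (All _) (sym edges-splice)
        (AllP.++⁺ (All.map inj₁ (SimplePath.within P)) (inj₂ refl ∷ All.map inj₁ (SimplePath.within Q)))
    }
    where
    ps qs : List Step
    ps = SimplePath.steps P
    qs = SimplePath.steps Q
    edges-splice : edges (ps ++ (y , e₀) ∷ qs) ≡ edges ps ++ e₀ ∷ edges qs
    edges-splice = ListP.map-++ proj₂ ps ((y , e₀) ∷ qs)
    labelsP = constant-along c c-edge (SimplePath.walk P) (SimplePath.within P)
    labelsQ = constant-along c c-edge (SimplePath.walk Q) (SimplePath.within Q)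
    onP = proj₁ labelsP
    srcP = proj₂ labelsP
    onQ = proj₁ labelsQ
    srcQ = proj₂ labelsQ

module Sweep (G : Graph) (f : Orientation G) where
  open Graph G
  open Orientations G
  open Walks G

  record Components (D : Pred (E G) 0ℓ) : Set where
    field
      label          : V G → V G
      potential      : V G → ℤ
      label-edge     : ∀ {e} → D e → label (src e) ≡ label (tgt e)
      potential-edge : ∀ {e} → D e → potential (tail G f e) < potential (head G f e)
      connect        : ∀ u v → label u ≡ label v → SimplePath D u v

  no-edges : ∀ {D} → Empty D → Components D
  no-edges {D} none = record
    { label = λ u → u ; potential = λ _ → 0ℤ ; label-edge = λ {e} d → ⊥-elim (none e d)
    ; potential-edge = λ {e} d → ⊥-elim (none e d) ; connect = connect-self }
    where
    connect-self : ∀ u v → u ≡ v → SimplePath D u v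
    connect-self u .u refl = trivial-path

  transfer : ∀ {D D'} → D ⊆ D' → D' ⊆ D → Components D → Components D'
  transfer D⊆D' D'⊆D C = record
    { label = label ; potential = potential
    ; label-edge = label-edge ∘ D'⊆D ; potential-edge = potential-edge ∘ D'⊆D
    ; connect = λ u v eq → widen D⊆D' (connect u v eq) }
    where open Components C

  -- Adding an edge e₀ = (a → b under f): if a and b are already in one class the
  -- path between them closes a cycle; otherwise merge the class of b into that of
  -- a, shifting its potential so that p b = p a + 1.
  module AddEdge {D : Pred (E G) 0ℓ} (C : Components D) (e₀ : E G) (e₀∉D : e₀ ∉ D) where
    open Components C

    a b : V G
    a = tail G f e₀
    b = head G f e₀

    joins-ab : Joins G e₀ a b
    joins-ab = joins-tail-head f e₀

    module Merge (apart : label a ≢ label b) where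
      shift : ℤ
      shift = ℤ.suc (potential a) - potential b

      moving : V G → Bool
      moving u = does (label u ≟ label b)

      label' : V G → V G
      label' u = if moving u then label a else label u

      potential' : V G → ℤ
      potential' u = if moving u then potential u + shift else potential u

      data Side (u : V G) : Set where
        moved : label u ≡ label b → label' u ≡ label a → potential' u ≡ potential u + shift → Side u
        kept  : label u ≢ label b → label' u ≡ label u → potential' u ≡ potential u → Side u

      side : ∀ u → Side u
      side u with label u ≟ label b
      ... | yes inB = moved inB (cong (λ t → if t then label a else label u) moves)
                                (cong (λ t → if t then potential u + shift else potential u) moves)
        where moves = dec-true (label u ≟ label b) inB
      ... | no notB = kept notB (cong (λ t → if t then label a else label u) stays)
                                (cong (λ t → if t then potential u + shift else potential u) stays)
        where stays = dec-false (label u ≟ label b) notB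

      same-class : ∀ {u v} → label u ≡ label v
        → label' u ≡ label' v × (potential u < potential v → potential' u < potential' v)
      same-class {u} {v} eq with side u | side v
      ... | moved _ lu pu | moved _ lv pv =
        trans lu (sym lv) , λ lt → subst₂ _<_ (sym pu) (sym pv) (ℤP.+-monoˡ-< shift lt)
      ... | kept _ lu pu | kept _ lv pv =
        trans lu (trans eq (sym lv)) , λ lt → subst₂ _<_ (sym pu) (sym pv) lt
      ... | moved inB _ _ | kept notB _ _ = ⊥-elim (notB (trans (sym eq) inB))
      ... | kept notB _ _ | moved inB _ _ = ⊥-elim (notB (trans eq inB))

      a-kept : label' a ≡ label a × potential' a ≡ potential a
      a-kept with side a
      ... | moved inB _ _ = ⊥-elim (apart inB)
      ... | kept _ la pa = la , pa

      b-moved : label' b ≡ label a × potential' b ≡ ℤ.suc (potential a)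
      b-moved with side b
      ... | moved _ lb pb = lb , trans pb (shift-lands (ℤ.suc (potential a)) (potential b))
        where
        shift-lands : ∀ z y → y + (z - y) ≡ z
        shift-lands = solve-∀
      ... | kept notB _ _ = ⊥-elim (notB refl)

      label-edge' : ∀ {e} → (D ∪ ｛ e₀ ｝) e → label' (src e) ≡ label' (tgt e)
      label-edge' (inj₁ d)    = proj₁ (same-class (label-edge d))
      label-edge' (inj₂ refl) = labels-across label' (trans (proj₁ a-kept) (sym (proj₁ b-moved))) joins-ab

      potential-edge' : ∀ {e} → (D ∪ ｛ e₀ ｝) e → potential' (tail G f e) < potential' (head G f e)
      potential-edge' {e} (inj₁ d) =
        proj₂ (same-class (sym (proj₂ (labels-along label (label-edge d) (joins-tail-head f e)))))
              (potential-edge d)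
      potential-edge' (inj₂ refl) =
        subst₂ _<_ (sym (proj₂ a-kept)) (sym (proj₂ b-moved)) (ℤP.suc[i]≤j⇒i<j ℤP.≤-refl)

      connect' : ∀ u v → label' u ≡ label' v → SimplePath (D ∪ ｛ e₀ ｝) u v
      connect' u v eq with side u | side v
      ... | moved inB _ _ | moved inB' _ _ = widen inj₁ (connect u v (trans inB (sym inB')))
      ... | kept _ lu _ | kept _ lv _ = widen inj₁ (connect u v (trans (sym lu) (trans eq lv)))
      ... | moved inB lu _ | kept _ lv _ =
        splice label label-edge e₀∉D (connect u b inB) (joins-sym joins-ab)
               (connect a v (trans (sym lu) (trans eq lv))) (λ u~a → apart (trans (sym u~a) inB))
      ... | kept notB lu _ | moved inB lv _ =
        splice label label-edge e₀∉D (connect u a (trans (sym lu) (trans eq lv))) joins-ab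
               (connect b v (sym inB)) notB

      merged : Components (D ∪ ｛ e₀ ｝)
      merged = record { label = label' ; potential = potential' ; label-edge = label-edge'
                      ; potential-edge = potential-edge' ; connect = connect' }

    add-edge : (Y : EdgeSet G) → D ⊆ (λ e → Y e ≡ true) → Y e₀ ≡ true
      → HasCycle G Y ⊎ Components (D ∪ ｛ e₀ ｝)
    add-edge Y D⊆Y e₀∈Y with label a ≟ label b
    ... | yes same  = inj₁ (close-cycle Y D⊆Y e₀∈Y e₀∉D joins-ab (connect b a (sym same)))
    ... | no  apart = inj₂ (Merge.merged apart)

  open AddEdge using (add-edge)

  module _ (Y : EdgeSet G) where
    processed : ℕ → Pred (E G) 0ℓ
    processed j e = Y e ≡ true × toℕ e ℕ.< j

    next-edge : ∀ j → processed (suc j) ⊆ processed j ⊎ Σ (E G) λ e₀ → Y e₀ ≡ true × toℕ e₀ ≡ j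
    next-edge j with FinP.any? (λ e → (Y e BoolP.≟ true) ×-dec (toℕ e ℕP.≟ j))
    ... | yes found = inj₂ found
    ... | no  none  = inj₁ λ {e} (y , lt) → y , ℕP.≤∧≢⇒< (ℕP.m<1+n⇒m≤n lt) (λ eq → none (e , y , eq))

    processed-suc : ∀ {j e₀} → Y e₀ ≡ true → toℕ e₀ ≡ j
      → processed j ∪ ｛ e₀ ｝ ⊆ processed (suc j) × processed (suc j) ⊆ processed j ∪ ｛ e₀ ｝
    processed-suc {j} {e₀} e₀∈Y index = grow , shrink
      where
      grow : processed j ∪ ｛ e₀ ｝ ⊆ processed (suc j)
      grow (inj₁ (y , lt)) = y , ℕP.m<n⇒m<1+n lt
      grow (inj₂ refl)     = e₀∈Y , ℕP.≤-reflexive (cong suc index)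
      shrink : processed (suc j) ⊆ processed j ∪ ｛ e₀ ｝
      shrink {e} (y , lt) with toℕ e ℕP.≟ j
      ... | yes eq = inj₂ (FinP.toℕ-injective (trans index (sym eq)))
      ... | no  ne = inj₁ (y , ℕP.≤∧≢⇒< (ℕP.m<1+n⇒m≤n lt) ne)

    components-upto : ∀ j → HasCycle G Y ⊎ Components (processed j)
    components-upto zero = inj₂ (no-edges λ _ ())
    components-upto (suc j) with components-upto j
    ... | inj₁ cycle = inj₁ cycle
    ... | inj₂ C with next-edge j
    ...   | inj₁ nothing-new = inj₂ (transfer (λ (y , lt) → y , ℕP.m<n⇒m<1+n lt) nothing-new C)
    ...   | inj₂ (e₀ , e₀∈Y , index) =
      let (grow , shrink) = processed-suc e₀∈Y index
          e₀∉processed (_ , lt) = ℕP.<-irrefl index lt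
      in Sum.map₂ (transfer grow shrink) (add-edge C e₀ e₀∉processed Y proj₁ e₀∈Y)

    forest-or-potential : HasCycle G Y ⊎ Σ (V G → ℤ) λ p → ∀ e → Y e ≡ true → p (tail G f e) < p (head G f e)
    forest-or-potential with components-upto m
    ... | inj₁ cycle = inj₁ cycle
    ... | inj₂ C = inj₂ (potential , λ e y → potential-edge (y , FinP.toℕ<n e))
      where open Components C

module Theorem (G : Graph) where
  open Orientations G
  open Sweep G using (forest-or-potential)

  star-inside : ∀ (g h : Orientation G) X e → X e ≡ true → (_⋆[_]_ G g X h) e ≡ h e
  star-inside g h X e inside = cong (λ t → if t then h e else g e) inside

  star-outside : ∀ (g h : Orientation G) X e → compl G X e ≡ true → (_⋆[_]_ G g X h) e ≡ g e
  star-outside g h X e outside with X e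
  ... | false = refl
  star-outside g h X e () | true

  star-cases : ∀ (g h : Orientation G) X e
    → (X e ≡ true × (_⋆[_]_ G g X h) e ≡ h e) ⊎ (compl G X e ≡ true × (_⋆[_]_ G g X h) e ≡ g e)
  star-cases g h X e with X e
  ... | true  = inj₁ (refl , refl)
  ... | false = inj₂ (refl , refl)

  cocycle⇔strongly-shattered : (X : EdgeSet G) → HasCycle G (compl G X) ⇔ StronglyShatters G (S-cyc G) X
  cocycle⇔strongly-shattered X = mk⇔ cocycle⇒strong strong⇒cocycle
    where
    cocycle⇒strong : HasCycle G (compl G X) → StronglyShatters G (S-cyc G) X
    cocycle⇒strong cycle =
      let (g , forces) = cycle-orientation (compl G X) cycle
      in g , λ h → forces (_⋆[_]_ G g X h) (λ e outside → star-outside g h X e outside)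

    -- Otherwise a potential for g on E ∖ X, completed upward on X, is acyclic.
    strong⇒cocycle : StronglyShatters G (S-cyc G) X → HasCycle G (compl G X)
    strong⇒cocycle (g , all-cyclic) with forest-or-potential g (compl G X)
    ... | inj₁ cycle = cycle
    ... | inj₂ (p , increasing) = ⊥-elim (acyclic-mix (_⋆[_]_ G g X up) g cases (all-cyclic up))
      where
      open PotentialOrder G p
      up = upward _≺?_
      cases : ∀ e → (_⋆[_]_ G g X up) e ≡ up e ⊎ ((_⋆[_]_ G g X up) e ≡ g e × p (tail G g e) < p (head G g e))
      cases e with star-cases g up X e
      ... | inj₁ (_ , o≡up)       = inj₁ o≡up
      ... | inj₂ (outside , o≡g) = inj₂ (o≡g , increasing e outside)

  forest⇔shattered : (X : EdgeSet G) → IsForest G X ⇔ Shatters G (S-acyc G) X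
  forest⇔shattered X = mk⇔ forest⇒shattered shattered⇒forest
    where
    -- A potential for h on X, completed upward off X, is acyclic.
    forest⇒shattered : IsForest G X → Shatters G (S-acyc G) X
    forest⇒shattered forest h with forest-or-potential h X
    ... | inj₁ cycle = ⊥-elim (forest cycle)
    ... | inj₂ (p , increasing) = up , acyclic-mix (_⋆[_]_ G up X h) h cases
      where
      open PotentialOrder G p
      up = upward _≺?_
      cases : ∀ e → (_⋆[_]_ G up X h) e ≡ up e ⊎ ((_⋆[_]_ G up X h) e ≡ h e × p (tail G h e) < p (head G h e))
      cases e with star-cases up h X e
      ... | inj₁ (inside , o≡h) = inj₂ (o≡h , increasing e inside)
      ... | inj₂ (_ , o≡up)      = inj₁ o≡up

    -- A cycle in X, oriented as a directed cycle, cannot be extended acyclically.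
    shattered⇒forest : Shatters G (S-acyc G) X → IsForest G X
    shattered⇒forest shatters cycle =
      let (g , forces) = cycle-orientation X cycle
          (g' , acyclic) = shatters g
      in acyclic (forces (_⋆[_]_ G g' X g) (λ e inside → star-inside g' g X e inside))

lemma3p2 : (G : Graph)
    → ((X : EdgeSet G) → HasCycle G (compl G X) ⇔ StronglyShatters G (S-cyc G) X)
    × ((X : EdgeSet G) → IsForest G X ⇔ Shatters G (S-acyc G) X)
lemma3p2 G = Theorem.cocycle⇔strongly-shattered G , Theorem.forest⇔shattered G
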